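{- Let $r\ge 2$ and let $\mathcal{H}=\{H_1,\dots,H_n\}$ be a collection of $n$ matchings, each of size $N$, in an $r$-uniform hypergraph. Let $m$ be the size of a maximum rainbow matching for $\mathcal{H}$. Then $$(n-m)\frac{2N-(r+1)m}{r-1}\leq\frac12\binom{2r}{r}m.$$
   Context: A hypergraph is $r$-uniform if every edge has exactly $r$ vertices. A matching is a set of pairwise vertex-disjoint edges. Given a collection of matchings $H_1,\dots,H_n$ in a hypergraph (not necessarily disjoint from each other), a matching $M\subseteq \bigcup_{i=1}^n H_i$ is rainbow if there is an injection $\phi: M\to[n]$ such that every edge $e\in M$ belongs to $H_{\phi(e)}$. -}

module Defs where

open import Data.Nat using (ℕ; _≤_)
open import Data.Fin using (Fin)
open import Data.Fin.Subset using (Subset; ∣_∣) renaming (_∈_ to _∈ₛ_)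
open import Data.List using (List; length; lookup)
open import Data.List.Membership.Propositional using (_∈_)
open import Data.List.Relation.Unary.All using (All)
open import Data.List.Relation.Unary.AllPairs using (AllPairs)
open import Data.Product using (Σ; _×_)
open import Data.Empty using (⊥)
open import Function.Definitions using (Injective)
open import Relation.Binary.PropositionalEquality using (_≡_)

Edge : ℕ → Set
Edge V = Subset V

Disjoint : {V : ℕ} → Edge V → Edge V → Set
Disjoint e f = ∀ x → x ∈ₛ e → x ∈ₛ f → ⊥

-- a matching of r-uniform edges: every edge has exactly r vertices and the
-- edges are pairwise vertex-disjoint (the size of the matching is its length;
-- for r ≥ 1 pairwise disjointness forces the edges to be distinct)
IsMatching : {V : ℕ} → ℕ → List (Edge V) → Set
IsMatching r M = All (λ e → ∣ e ∣ ≡ r) M × AllPairs Disjoint M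

IsRainbow : {V n : ℕ} → (Fin n → List (Edge V)) → List (Edge V) → Set
IsRainbow {n = n} H M =
  AllPairs Disjoint M ×
  Σ (Fin (length M) → Fin n) (λ φ →
    Injective _≡_ _≡_ φ × (∀ k → lookup M k ∈ H (φ k)))

IsMaxRainbowSize : {V n : ℕ} → (Fin n → List (Edge V)) → ℕ → Set
IsMaxRainbowSize H m =
  Σ (List _) (λ M → IsRainbow H M × length M ≡ m) ×
  (∀ M → IsRainbow H M → length M ≤ m)

-- Fix a maximum rainbow matching M = {e₁, …, eₘ}; at least n − m colours are unused by M. An edge
-- f of an unused colour meets some eₐ, otherwise M + f would be a larger rainbow matching; f is
-- pure for eₐ when eₐ is the only edge of M it meets. A colour class is a matching, so its edges
-- meet eₐ at most r times in total, and counting the edges of an unused colour i twice (once through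
-- the edges of M they meet, once more if pure) gives 2N ≤ (r + 1)m + Σₐ (pᵢₐ − 1), where pᵢₐ ≤ r is
-- the number of pure edges of colour i for eₐ. Pure edges for the same eₐ of distinct unused colours
-- intersect, otherwise exchanging eₐ for both of them enlarges M. So for fixed eₐ, each unused
-- colour with two (necessarily disjoint) pure edges f, g contributes the pairs (f, g) and (g, f) to a
-- Bollobás system of r-sets, and Bollobás' theorem bounds the number of such colours by C(2r, r)/2;
-- as pᵢₐ − 1 ≤ r − 1, summing over a and over the unused colours finishes the proof.
--
-- Bollobás' theorem is proved in the weighted form Σₜ |Aₜ|! |Bₜ|! / (|Aₜ| + |Bₜ|)! ≤ 1: the t-th term
-- is the proportion of orderings of the ground set in which Aₜ entirely precedes Bₜ, these events
-- are pairwise exclusive, and the induction on the ground set splits the orderings according to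
-- their last element.

module Submission where

open import Defs
open import Data.Nat using (ℕ; _≤_; suc; _*_; _∸_)
open import Data.Nat.Combinatorics using (_C_)
open import Data.Fin using (Fin)
open import Data.List using (List; length)
open import Data.Integer using (+_) renaming (_*_ to _*ℤ_; _-_ to _-ℤ_; _≤_ to _≤ℤ_)
open import Relation.Binary.PropositionalEquality using (_≡_)

open import Data.Bool using (Bool; true; false; not; if_then_else_)
open import Data.Bool.Properties using (¬-not)
open import Data.Empty using (⊥-elim)
open import Data.Fin using (zero; suc; _↑ˡ_; _↑ʳ_; splitAt; join; cast; punchIn)
import Data.Fin as Fin
import Data.Fin.Properties as Finₚ
open import Data.Fin.Properties using (any?; all?; splitAt-↑ˡ; splitAt-↑ʳ; join-splitAt)
open import Data.Fin.Subset
  using (Subset; Nonempty; ∣_∣; _⊆_; _-_; _─_; ⊤; ⊥; inside; outside)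
  renaming (_∈_ to _∈ₛ_; _∉_ to _∉ₛ_)
open import Data.Fin.Subset.Properties
  using ( _∈?_; nonempty?; p─⊥≡p; p─q⊆p; x∈p∧x≢y⇒x∈p-y; x∈p∧x∉q⇒x∈p─q; x∉⁅y⁆⇒x≢y; x∈p∩q⁺
        ; x∈p⇒∣p-x∣<∣p∣; p∩q≢∅⇒∣p─q∣<∣p∣; ∣p∣≤n; ∣∁p∣≡n∸∣p∣; p⊆q⇒∣p∣≤∣q∣; x∉p⇒x∈∁p
        ; Empty-unique; ∣⊥∣≡0; ∈⊤; ∣⊤∣≡n )
open import Data.Integer using (-_; +≤+)
import Data.Integer.Properties as ℤ
open import Data.List using ([]; _∷_; lookup; tabulate; map; filter)
open import Data.List.Properties using (length-tabulate; lookup-tabulate)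
open import Data.List.Membership.Propositional using (_∈_)
open import Data.List.Membership.Propositional.Properties using (∈-lookup; ∈-filter⁻)
open import Data.List.Relation.Unary.Any using (here; there)
import Data.List.Relation.Unary.All as All
open import Data.List.Relation.Unary.AllPairs using (AllPairs; []; _∷_)
import Data.List.Relation.Unary.AllPairs.Properties as AllPairs
open import Data.Nat hiding (_≟_; ∣_-_∣)
open import Data.Nat.Combinatorics using (k![n∸k]!∣n!)
open import Data.Nat.Combinatorics.Specification using (nCk≡n!/k![n-k]!)
open import Data.Nat.DivMod using (m/n*n≡m)
import Data.Nat.ListAction as List
open import Data.Nat.Properties
open import Algebra.Properties.CommutativeSemigroup +-commutativeSemigroup using (interchange)
open import Algebra.Properties.Semiring.Sum +-*-semiring
  using ( sum; sum-syntax; sum-cong-≗; sum-replicate-zero; ∑-distrib-+; ∑-comm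
        ; *-distribˡ-sum; *-distribʳ-sum )
open import Data.Nat.Tactic.RingSolver using (solve-∀)
open import Data.Product using (∃-syntax; _×_; _,_; proj₁; proj₂)
open import Data.Sum using (inj₁; inj₂; [_,_]′)
import Data.Vec as Vec
import Data.Vec.Functional as Vector
open import Function using (_∘′_)
open import Function.Definitions using (Injective)
open import Level using (0ℓ)
open import Relation.Binary.Definitions using (Symmetric)
open import Relation.Binary.PropositionalEquality
open import Relation.Nullary using (Dec; does; yes; no; ¬_; ¬?; contradiction)
open import Relation.Nullary.Decidable using (_×-dec_; dec-true; dec-false)
open import Relation.Unary using (Pred; Decidable)

-- Finite sums

𝟙 : ∀ {p} {P : Set p} → Dec P → ℕ
𝟙 d = if does d then 1 else 0

𝟙-yes : ∀ {p} {P : Set p} (d : Dec P) → P → 𝟙 d ≡ 1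
𝟙-yes d p rewrite dec-true d p = refl

𝟙-no : ∀ {p} {P : Set p} (d : Dec P) → ¬ P → 𝟙 d ≡ 0
𝟙-no d ¬p rewrite dec-false d ¬p = refl

𝟙-×-dec : ∀ {p q} {P : Set p} {Q : Set q} (p? : Dec P) (q? : Dec Q) → 𝟙 (p? ×-dec q?) ≡ 𝟙 p? * 𝟙 q?
𝟙-×-dec (yes _) q? = sym (+-identityʳ (𝟙 q?))
𝟙-×-dec (no  _) q? = refl

𝟙-mono : ∀ {p q} {P : Set p} {Q : Set q} → (P → Q) → (p? : Dec P) (q? : Dec Q) → 𝟙 p? ≤ 𝟙 q?
𝟙-mono P→Q (no _)  _       = z≤n
𝟙-mono P→Q (yes p) (yes _) = ≤-refl
𝟙-mono P→Q (yes p) (no ¬q) = contradiction (P→Q p) ¬q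

𝟙-*-monoʳ-≤ : ∀ {p} {P : Set p} {x y} (p? : Dec P) → (P → x ≤ y) → 𝟙 p? * x ≤ 𝟙 p? * y
𝟙-*-monoʳ-≤ (yes p) x≤y = *-monoʳ-≤ 1 (x≤y p)
𝟙-*-monoʳ-≤ (no  _) _   = z≤n

∑-mono-≤ : ∀ {n} {f g : Fin n → ℕ} → (∀ i → f i ≤ g i) → sum f ≤ sum g
∑-mono-≤ {zero}  f≤g = z≤n
∑-mono-≤ {suc n} f≤g = +-mono-≤ (f≤g zero) (∑-mono-≤ (λ i → f≤g (suc i)))

∑-zero : ∀ {n} {f : Fin n → ℕ} → (∀ i → f i ≡ 0) → sum f ≡ 0
∑-zero {n} f≗0 = trans (sum-cong-≗ f≗0) (sum-replicate-zero n)

∑-const : ∀ n c → ∑[ i < n ] c ≡ n * c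
∑-const zero    c = refl
∑-const (suc n) c = cong (_+_ c) (∑-const n c)

∑-single : ∀ {n} (f : Fin n → ℕ) i → (∀ j → j ≢ i → f j ≡ 0) → sum f ≡ f i
∑-single f zero    others =
  trans (cong (_+_ (f zero)) (∑-zero (λ j → others (suc j) λ ()))) (+-identityʳ (f zero))
∑-single f (suc i) others = trans (cong (_+ ∑[ j < _ ] f (suc j)) (others zero λ ()))
  (∑-single (λ j → f (suc j)) i (λ j j≢i → others (suc j) (j≢i ∘′ Finₚ.suc-injective)))

f[i]≤∑f : ∀ {n} (f : Fin n → ℕ) i → f i ≤ sum f
f[i]≤∑f f zero    = m≤m+n (f zero) _
f[i]≤∑f f (suc i) = ≤-trans (f[i]≤∑f (λ j → f (suc j)) i) (m≤n+m _ (f zero))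

f[i]+f[j]≤∑f : ∀ {n} (f : Fin n → ℕ) {i j} → i ≢ j → f i + f j ≤ sum f
f[i]+f[j]≤∑f f {zero}  {zero}  i≢j = contradiction refl i≢j
f[i]+f[j]≤∑f f {zero}  {suc j} _   = +-monoʳ-≤ (f zero) (f[i]≤∑f (λ k → f (suc k)) j)
f[i]+f[j]≤∑f f {suc i} {zero}  _   =
  subst (_≤ sum f) (+-comm (f zero) (f (suc i))) (+-monoʳ-≤ (f zero) (f[i]≤∑f (λ k → f (suc k)) i))
f[i]+f[j]≤∑f f {suc i} {suc j} i≢j =
  ≤-trans (f[i]+f[j]≤∑f (λ k → f (suc k)) (i≢j ∘′ cong suc)) (m≤n+m _ (f zero))

∑-split : ∀ m {n} (f : Fin (m + n) → ℕ) → sum f ≡ ∑[ i < m ] f (i ↑ˡ n) + ∑[ j < n ] f (m ↑ʳ j)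
∑-split zero    f = refl
∑-split (suc m) f =
  trans (cong (_+_ (f zero)) (∑-split m (λ t → f (suc t)))) (sym (+-assoc (f zero) _ _))

∑ˡ : ∀ {a} {A : Set a} → List A → (A → ℕ) → ℕ
∑ˡ xs f = List.sum (map f xs)

infixl 10 ∑ˡ
syntax ∑ˡ xs (λ x → e) = ∑[ x ∈ xs ] e

∑ˡ-const : ∀ {a} {A : Set a} (xs : List A) c → ∑[ x ∈ xs ] c ≡ length xs * c
∑ˡ-const []       c = refl
∑ˡ-const (x ∷ xs) c = cong (_+_ c) (∑ˡ-const xs c)

∑ˡ-mono-≤ : ∀ {a} {A : Set a} (xs : List A) {f g : A → ℕ} →
  (∀ {x} → x ∈ xs → f x ≤ g x) → ∑ˡ xs f ≤ ∑ˡ xs g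
∑ˡ-mono-≤ []       f≤g = z≤n
∑ˡ-mono-≤ (x ∷ xs) f≤g = +-mono-≤ (f≤g (here refl)) (∑ˡ-mono-≤ xs (λ x∈xs → f≤g (there x∈xs)))

∑ˡ-distrib-+ : ∀ {a} {A : Set a} (xs : List A) (f g : A → ℕ) →
  ∑[ x ∈ xs ] (f x + g x) ≡ ∑ˡ xs f + ∑ˡ xs g
∑ˡ-distrib-+ []       f g = refl
∑ˡ-distrib-+ (x ∷ xs) f g =
  trans (cong (_+_ (f x + g x)) (∑ˡ-distrib-+ xs f g)) (interchange (f x) (g x) (∑ˡ xs f) (∑ˡ xs g))

∑-∑ˡ-comm : ∀ {a m} {A : Set a} (xs : List A) (f : Fin m → A → ℕ) →
  ∑[ k < m ] ∑[ x ∈ xs ] f k x ≡ ∑[ x ∈ xs ] ∑[ k < m ] f k x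
∑-∑ˡ-comm {m = m} []       f = ∑-zero {m} (λ _ → refl)
∑-∑ˡ-comm {m = m} (x ∷ xs) f = trans (∑-distrib-+ (λ k → f k x) (λ k → ∑[ y ∈ xs ] f k y))
                                     (cong (_+_ (∑[ k < m ] f k x)) (∑-∑ˡ-comm xs f))

∑ˡ-𝟙≡length-filter : ∀ {a p} {A : Set a} {P : Pred A p} (P? : Decidable P) xs →
  ∑[ x ∈ xs ] 𝟙 (P? x) ≡ length (filter P? xs)
∑ˡ-𝟙≡length-filter P? []       = refl
∑ˡ-𝟙≡length-filter P? (x ∷ xs) with does (P? x)
... | true  = cong suc (∑ˡ-𝟙≡length-filter P? xs)
... | false = ∑ˡ-𝟙≡length-filter P? xs

-- Finite sets

Meets : ∀ {V} → Subset V → Subset V → Set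
Meets p q = ∃[ x ] x ∈ₛ p × x ∈ₛ q

meets? : ∀ {V} (p q : Subset V) → Dec (Meets p q)
meets? p q = any? (λ x → x ∈? p ×-dec x ∈? q)

¬meets⇒disjoint : ∀ {V} {p q : Subset V} → ¬ Meets p q → Disjoint p q
¬meets⇒disjoint ¬p∩q x x∈p x∈q = ¬p∩q (x , x∈p , x∈q)

Disjoint-sym : ∀ {V} → Symmetric (Disjoint {V})
Disjoint-sym p∩q≡∅ x x∈q x∈p = p∩q≡∅ x x∈p x∈q

x∈p─q⇒x∉q : ∀ {V x} (p q : Subset V) → x ∈ₛ p ─ q → x ∉ₛ q
x∈p─q⇒x∉q (inside Vec.∷ p) (outside Vec.∷ q) Vec.here        ()
x∈p─q⇒x∉q (_      Vec.∷ p) (_       Vec.∷ q) (Vec.there x∈) (Vec.there x∈q) = x∈p─q⇒x∉q p q x∈ x∈q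

∣p∣≡∑𝟙 : ∀ {n} (p : Subset n) → ∣ p ∣ ≡ ∑[ x < n ] 𝟙 (x ∈? p)
∣p∣≡∑𝟙 Vec.[]            = refl
∣p∣≡∑𝟙 (inside  Vec.∷ p) = cong suc (∣p∣≡∑𝟙 p)
∣p∣≡∑𝟙 (outside Vec.∷ p) = ∣p∣≡∑𝟙 p

x∈p⇒suc∣p-x∣≡∣p∣ : ∀ {n x} {p : Subset n} → x ∈ₛ p → suc ∣ p - x ∣ ≡ ∣ p ∣
x∈p⇒suc∣p-x∣≡∣p∣ {p = inside  Vec.∷ p} Vec.here        = cong (suc ∘′ ∣_∣) (p─⊥≡p p)
x∈p⇒suc∣p-x∣≡∣p∣ {p = inside  Vec.∷ p} (Vec.there x∈p) = cong suc (x∈p⇒suc∣p-x∣≡∣p∣ x∈p)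
x∈p⇒suc∣p-x∣≡∣p∣ {p = outside Vec.∷ p} (Vec.there x∈p) = x∈p⇒suc∣p-x∣≡∣p∣ x∈p

x∉p⇒∣p-x∣≡∣p∣ : ∀ {n x} {p : Subset n} → x ∉ₛ p → ∣ p - x ∣ ≡ ∣ p ∣
x∉p⇒∣p-x∣≡∣p∣ {x = zero}  {inside  Vec.∷ p} x∉p = contradiction Vec.here x∉p
x∉p⇒∣p-x∣≡∣p∣ {x = zero}  {outside Vec.∷ p} x∉p = cong ∣_∣ (p─⊥≡p p)
x∉p⇒∣p-x∣≡∣p∣ {x = suc x} {inside  Vec.∷ p} x∉p = cong suc (x∉p⇒∣p-x∣≡∣p∣ (x∉p ∘′ Vec.there))
x∉p⇒∣p-x∣≡∣p∣ {x = suc x} {outside Vec.∷ p} x∉p = x∉p⇒∣p-x∣≡∣p∣ (x∉p ∘′ Vec.there)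

x∈p⇒∣p∣≢0 : ∀ {n x} {p : Subset n} → x ∈ₛ p → ∣ p ∣ ≢ 0
x∈p⇒∣p∣≢0 {x = x} {p} x∈p ∣p∣≡0 = n≮0 (subst (∣ p - x ∣ <_) ∣p∣≡0 (x∈p⇒∣p-x∣<∣p∣ x∈p))

∣p∣≢0⇒nonempty : ∀ {n} {p : Subset n} → ∣ p ∣ ≢ 0 → Nonempty p
∣p∣≢0⇒nonempty {n} {p} ∣p∣≢0 with nonempty? p
... | yes ne  = ne
... | no  ¬ne = contradiction (trans (cong ∣_∣ (Empty-unique ¬ne)) (∣⊥∣≡0 n)) ∣p∣≢0

∣p∣+∣q∣≤n : ∀ {n} {p q : Subset n} → Disjoint p q → ∣ p ∣ + ∣ q ∣ ≤ n
∣p∣+∣q∣≤n {n} {p} {q} p∩q≡∅ = subst (_≤ n) (+-comm ∣ q ∣ ∣ p ∣)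
  (m≤o∸n⇒m+n≤o ∣ q ∣ (∣p∣≤n p) (subst (∣ q ∣ ≤_) (∣∁p∣≡n∸∣p∣ p)
    (p⊆q⇒∣p∣≤∣q∣ (λ x∈q → x∉p⇒x∈∁p (λ x∈p → p∩q≡∅ _ x∈p x∈q)))))

∑-meets≤∣e∣ : ∀ {V} (L : List (Subset V)) (e : Subset V) → AllPairs Disjoint L →
  ∑[ f ∈ L ] 𝟙 (meets? f e) ≤ ∣ e ∣
∑-meets≤∣e∣ []      e []                     = z≤n
∑-meets≤∣e∣ (f ∷ L) e (f∩L≡∅ ∷ L-disjoint) with meets? f e
... | no  _                 = ∑-meets≤∣e∣ L e L-disjoint
... | yes (x , x∈f , x∈e) = begin-strict
  ∑[ g ∈ L ] 𝟙 (meets? g e)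
    ≤⟨ ∑ˡ-mono-≤ L (λ g∈L → 𝟙-mono (meets-e─f g∈L) (meets? _ e) (meets? _ (e ─ f))) ⟩
  ∑[ g ∈ L ] 𝟙 (meets? g (e ─ f))
    ≤⟨ ∑-meets≤∣e∣ L (e ─ f) L-disjoint ⟩
  ∣ e ─ f ∣
    <⟨ p∩q≢∅⇒∣p─q∣<∣p∣ e f (x , x∈p∩q⁺ (x∈e , x∈f)) ⟩
  ∣ e ∣
    ∎
  where
  open ≤-Reasoning
  meets-e─f : ∀ {g} → g ∈ L → Meets g e → Meets g (e ─ f)
  meets-e─f g∈L (y , y∈g , y∈e) = y , y∈g , x∈p∧x∉q⇒x∈p─q y∈e (λ y∈f → All.lookup f∩L≡∅ g∈L y y∈f y∈g)

-- ⊥ is a junk value, returned only for lists with fewer than two elements.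
pickTwo : ∀ {V} → List (Subset V) → Bool → Subset V
pickTwo (f ∷ g ∷ _) true  = f
pickTwo (f ∷ g ∷ _) false = g
pickTwo _           _     = ⊥

pickTwo-∈ : ∀ {V} {xs : List (Subset V)} → 2 ≤ length xs → ∀ b → pickTwo xs b ∈ xs
pickTwo-∈ {xs = f ∷ g ∷ _} _        true  = here refl
pickTwo-∈ {xs = f ∷ g ∷ _} _        false = there (here refl)
pickTwo-∈ {xs = _ ∷ []}    (s≤s ()) _

pickTwo-related : ∀ {V r} {R : Subset V → Subset V → Set r} {xs} → 2 ≤ length xs → AllPairs R xs →
  R (pickTwo xs true) (pickTwo xs false)
pickTwo-related {xs = f ∷ g ∷ _} _        ((Rfg All.∷ _) ∷ _) = Rfg
pickTwo-related {xs = _ ∷ []}    (s≤s ()) _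

-- Bollobás' theorem

-- orderings s a b = s! a! b! / (a + b)! is the number of orderings of an s-element set in which a
-- given a-subset entirely precedes a given disjoint b-subset; the recursion is on the last element.
orderings : ℕ → ℕ → ℕ → ℕ
orderings s       a zero    = s !
orderings zero    a (suc b) = 0
orderings (suc s) a (suc b) = (s ∸ (a + b)) * orderings s a (suc b) + suc b * orderings s a b

orderings-closed-form : ∀ s a b → a + b ≤ s → orderings s a b * (a + b) ! ≡ s ! * (a ! * b !)
orderings-closed-form s       a zero    _ = begin
  s ! * (a + 0) !   ≡⟨ cong (λ c → s ! * c !) (+-identityʳ a) ⟩
  s ! * a !         ≡⟨ cong (s ! *_) (*-identityʳ (a !)) ⟨
  s ! * (a ! * 1)   ∎
  where open ≡-Reasoning
orderings-closed-form zero    a (suc b) a+b<0 =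
  contradiction (≤-trans (≤-reflexive (sym (+-suc a b))) a+b<0) λ ()
orderings-closed-form (suc s) a (suc b) a+b<s = begin
  (d * w₁ + suc b * w₀) * (a + suc b) !
    ≡⟨ cong (λ c → (d * w₁ + suc b * w₀) * c !) (+-suc a b) ⟩
  (d * w₁ + suc b * w₀) * (suc c * c !)
    ≡⟨ distribute d w₁ b w₀ c (c !) ⟩
  d * (w₁ * (suc c * c !)) + suc c * (suc b * (w₀ * c !))
    ≡⟨ cong₂ _+_ first-summand (cong (λ x → suc c * (suc b * x)) (orderings-closed-form s a b c≤s)) ⟩
  d * (s ! * (a ! * (suc b * b !))) + suc c * (suc b * (s ! * (a ! * b !)))
    ≡⟨ collect d c (s !) (a !) b (b !) ⟩
  (d + suc c) * s ! * (a ! * (suc b * b !))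
    ≡⟨ cong (λ x → x * s ! * (a ! * (suc b * b !))) (trans (+-suc d c) (cong suc (m∸n+n≡m c≤s))) ⟩
  suc s * s ! * (a ! * suc b !)
    ∎
  where
  open ≡-Reasoning
  c d w₁ w₀ : ℕ
  c = a + b
  d = s ∸ c
  w₁ = orderings s a (suc b)
  w₀ = orderings s a b
  c≤s : c ≤ s
  c≤s = ≤-pred (≤-trans (≤-reflexive (sym (+-suc a b))) a+b<s)
  distribute : ∀ d w₁ b w₀ c c! →
    (d * w₁ + suc b * w₀) * (suc c * c!) ≡ d * (w₁ * (suc c * c!)) + suc c * (suc b * (w₀ * c!))
  distribute = solve-∀
  collect : ∀ d c s! a! b b! →
    d * (s! * (a! * (suc b * b!))) + suc c * (suc b * (s! * (a! * b!))) ≡ (d + suc c) * s! * (a! * (suc b * b!))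
  collect = solve-∀
  -- Either d = 0, or a + suc b ≤ s and the induction hypothesis applies.
  first-summand : d * (w₁ * (suc c * c !)) ≡ d * (s ! * (a ! * (suc b * b !)))
  first-summand with m≤n⇒m<n∨m≡n c≤s
  ... | inj₁ c<s = cong (d *_) (trans (cong (λ x → w₁ * x !) (sym (+-suc a b)))
                                      (orderings-closed-form s a (suc b) (≤-trans (≤-reflexive (+-suc a b)) c<s)))
  ... | inj₂ c≡s = trans (cong (_* (w₁ * (suc c * c !))) d≡0)
                         (sym (cong (_* (s ! * (a ! * (suc b * b !)))) d≡0))
    where
    d≡0 : d ≡ 0
    d≡0 = m≤n⇒m∸n≡0 (≤-reflexive (sym c≡s))

module _ {V : ℕ} (X A B : Subset V) (A⊆X : A ⊆ X) (B⊆X : B ⊆ X) (A∩B≡∅ : Disjoint A B) where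

  outside-A∪B : Fin V → ℕ
  outside-A∪B x = 𝟙 (x ∈? X) * 𝟙 (¬? (x ∈? A)) * 𝟙 (¬? (x ∈? B))

  𝟙-partition : ∀ x → 𝟙 (x ∈? X) ≡ 𝟙 (x ∈? A) + 𝟙 (x ∈? B) + outside-A∪B x
  𝟙-partition x with x ∈? A | x ∈? B
  ... | yes x∈A | yes x∈B = ⊥-elim (A∩B≡∅ x x∈A x∈B)
  ... | yes x∈A | no  _   rewrite 𝟙-yes (x ∈? X) (A⊆X x∈A) = refl
  ... | no  _   | yes x∈B rewrite 𝟙-yes (x ∈? X) (B⊆X x∈B) = refl
  ... | no  _   | no  _   = sym (trans (*-identityʳ _) (*-identityʳ _))

  ∣X∣≡∣A∣+∣B∣+∑outside : ∣ X ∣ ≡ ∣ A ∣ + ∣ B ∣ + sum outside-A∪B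
  ∣X∣≡∣A∣+∣B∣+∑outside = begin
    ∣ X ∣
      ≡⟨ ∣p∣≡∑𝟙 X ⟩
    ∑[ x < V ] 𝟙 (x ∈? X)
      ≡⟨ sum-cong-≗ 𝟙-partition ⟩
    ∑[ x < V ] (𝟙 (x ∈? A) + 𝟙 (x ∈? B) + outside-A∪B x)
      ≡⟨ ∑-distrib-+ (λ x → 𝟙 (x ∈? A) + 𝟙 (x ∈? B)) outside-A∪B ⟩
    ∑[ x < V ] (𝟙 (x ∈? A) + 𝟙 (x ∈? B)) + sum outside-A∪B
      ≡⟨ cong (_+ sum outside-A∪B) (∑-distrib-+ (λ x → 𝟙 (x ∈? A)) (λ x → 𝟙 (x ∈? B))) ⟩
    ∑[ x < V ] 𝟙 (x ∈? A) + ∑[ x < V ] 𝟙 (x ∈? B) + sum outside-A∪B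
      ≡⟨ cong₂ (λ a b → a + b + sum outside-A∪B) (∣p∣≡∑𝟙 A) (∣p∣≡∑𝟙 B) ⟨
    ∣ A ∣ + ∣ B ∣ + sum outside-A∪B
      ∎
    where open ≡-Reasoning

  orderings-by-last-element : ∀ {s b} → ∣ X ∣ ≡ suc s → ∣ B ∣ ≡ suc b →
    ∑[ x < V ] (𝟙 (x ∈? X) * (𝟙 (¬? (x ∈? A)) * orderings s ∣ A ∣ ∣ B - x ∣)) ≡ orderings (suc s) ∣ A ∣ ∣ B ∣
  orderings-by-last-element {s} {b} ∣X∣≡1+s ∣B∣≡1+b = begin
    ∑[ x < V ] (𝟙 (x ∈? X) * (𝟙 (¬? (x ∈? A)) * orderings s a ∣ B - x ∣))
      ≡⟨ sum-cong-≗ last-element ⟩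
    ∑[ x < V ] (outside-A∪B x * w₁ + 𝟙 (x ∈? B) * w₀)
      ≡⟨ ∑-distrib-+ (λ x → outside-A∪B x * w₁) (λ x → 𝟙 (x ∈? B) * w₀) ⟩
    ∑[ x < V ] (outside-A∪B x * w₁) + ∑[ x < V ] (𝟙 (x ∈? B) * w₀)
      ≡⟨ cong₂ _+_ (*-distribʳ-sum w₁ outside-A∪B) (*-distribʳ-sum w₀ (λ x → 𝟙 (x ∈? B))) ⟨
    sum outside-A∪B * w₁ + (∑[ x < V ] 𝟙 (x ∈? B)) * w₀
      ≡⟨ cong₂ (λ u v → u * w₁ + v * w₀) ∑outside≡s∸[a+b] (trans (sym (∣p∣≡∑𝟙 B)) ∣B∣≡1+b) ⟩
    (s ∸ (a + b)) * w₁ + suc b * w₀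
      ≡⟨ cong (orderings (suc s) a) ∣B∣≡1+b ⟨
    orderings (suc s) a ∣ B ∣
      ∎
    where
    open ≡-Reasoning
    a w₁ w₀ : ℕ
    a = ∣ A ∣
    w₁ = orderings s a (suc b)
    w₀ = orderings s a b
    s≡a+b+∑outside : s ≡ a + b + sum outside-A∪B
    s≡a+b+∑outside = suc-injective (begin
      suc s                          ≡⟨ ∣X∣≡1+s ⟨
      ∣ X ∣                          ≡⟨ ∣X∣≡∣A∣+∣B∣+∑outside ⟩
      a + ∣ B ∣ + sum outside-A∪B    ≡⟨ cong (λ c → a + c + sum outside-A∪B) ∣B∣≡1+b ⟩
      a + suc b + sum outside-A∪B    ≡⟨ cong (_+ sum outside-A∪B) (+-suc a b) ⟩
      suc (a + b + sum outside-A∪B)  ∎)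
    ∑outside≡s∸[a+b] : sum outside-A∪B ≡ s ∸ (a + b)
    ∑outside≡s∸[a+b] = sym (trans (cong (_∸ (a + b)) s≡a+b+∑outside) (m+n∸m≡n (a + b) _))
    last-element : ∀ x → 𝟙 (x ∈? X) * (𝟙 (¬? (x ∈? A)) * orderings s a ∣ B - x ∣)
                         ≡ outside-A∪B x * w₁ + 𝟙 (x ∈? B) * w₀
    last-element x with x ∈? B
    ... | yes x∈B
      rewrite 𝟙-yes (x ∈? X) (B⊆X x∈B)
            | 𝟙-yes (¬? (x ∈? A)) (λ x∈A → A∩B≡∅ x x∈A x∈B)
            | suc-injective (trans (x∈p⇒suc∣p-x∣≡∣p∣ x∈B) ∣B∣≡1+b)
      = +-identityʳ _
    ... | no  x∉B rewrite trans (x∉p⇒∣p-x∣≡∣p∣ x∉B) ∣B∣≡1+b = reassociate (𝟙 (x ∈? X)) (𝟙 (¬? (x ∈? A))) w₁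
      where
      reassociate : ∀ u v w → u * (v * w) ≡ u * v * 1 * w + 0
      reassociate = solve-∀

record IsBollobásSystem {K V} (X : Subset V) (S : Pred (Fin K) 0ℓ) (A B : Fin K → Subset V) : Set where
  field
    A⊆X      : ∀ {t} → S t → A t ⊆ X
    B⊆X      : ∀ {t} → S t → B t ⊆ X
    disjoint : ∀ {t} → S t → Disjoint (A t) (B t)
    cross    : ∀ {t u} → S t → S u → t ≢ u → Meets (A t) (B u)

open IsBollobásSystem

delete-point : ∀ {K V} {X : Subset V} {S : Pred (Fin K) 0ℓ} {A B : Fin K → Subset V} →
  IsBollobásSystem X S A B → ∀ x → IsBollobásSystem (X - x) (λ t → S t × x ∉ₛ A t) A (λ t → B t - x)
delete-point sys x = record
  { A⊆X      = λ { (St , x∉A) y∈A → x∈p∧x≢y⇒x∈p-y (A⊆X sys St y∈A) (λ { refl → x∉A y∈A }) }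
  ; B⊆X      = λ { (St , _) {y} y∈B-x →
                   x∈p∧x≢y⇒x∈p-y (B⊆X sys St (p─q⊆p _ _ y∈B-x)) (x∉⁅y⁆⇒x≢y (x∈p─q⇒x∉q _ _ y∈B-x)) }
  ; disjoint = λ { (St , _) y y∈A y∈B-x → disjoint sys St y y∈A (p─q⊆p _ _ y∈B-x) }
  ; cross    = λ { (St , x∉A) (Su , _) t≢u → let (y , y∈A , y∈B) = cross sys St Su t≢u in
                   y , y∈A , x∈p∧x≢y⇒x∈p-y y∈B (λ { refl → x∉A y∈A }) }
  }

bollobás-weighted : ∀ {K V} s {X : Subset V} {S : Pred (Fin K) 0ℓ} (S? : Decidable S)
  {A B : Fin K → Subset V} → ∣ X ∣ ≡ s → IsBollobásSystem X S A B →
  ∑[ t < K ] (𝟙 (S? t) * orderings s ∣ A t ∣ ∣ B t ∣) ≤ s !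
-- The recursion of orderings needs Bₜ ≠ ∅; a pair with Bₜ = ∅ can only be alone, and has weight s!.
bollobás-weighted s S? {A} {B} _ sys with any? (λ t → S? t ×-dec (∣ B t ∣ ≟ 0))
... | yes (t₀ , St₀ , ∣Bt₀∣≡0) = ≤-reflexive (begin
  ∑[ t < _ ] (𝟙 (S? t) * orderings s ∣ A t ∣ ∣ B t ∣)
    ≡⟨ ∑-single _ t₀ others ⟩
  𝟙 (S? t₀) * orderings s ∣ A t₀ ∣ ∣ B t₀ ∣
    ≡⟨ cong₂ (λ u v → u * orderings s ∣ A t₀ ∣ v) (𝟙-yes (S? t₀) St₀) ∣Bt₀∣≡0 ⟩
  1 * s !
    ≡⟨ *-identityˡ _ ⟩
  s !
    ∎)
  where
  open ≡-Reasoning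
  others : ∀ t → t ≢ t₀ → 𝟙 (S? t) * orderings s ∣ A t ∣ ∣ B t ∣ ≡ 0
  others t t≢t₀ with S? t
  ... | no  _  = refl
  ... | yes St = let (_ , _ , x∈B) = cross sys St St₀ t≢t₀ in ⊥-elim (x∈p⇒∣p∣≢0 x∈B ∣Bt₀∣≡0)
bollobás-weighted zero S? {A} {B} _ _ | no ∄t = ≤-trans (≤-reflexive (∑-zero no-orderings)) z≤n
  where
  no-orderings : ∀ t → 𝟙 (S? t) * orderings 0 ∣ A t ∣ ∣ B t ∣ ≡ 0
  no-orderings t with S? t
  ... | no  _  = refl
  ... | yes St rewrite sym (suc-pred ∣ B t ∣ {{≢-nonZero (λ ∣Bt∣≡0 → ∄t (t , St , ∣Bt∣≡0))}}) = refl
bollobás-weighted {K} {V} (suc s) {X} {S} S? {A} {B} ∣X∣≡1+s sys | no ∄t = begin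
  ∑[ t < K ] (𝟙 (S? t) * orderings (suc s) ∣ A t ∣ ∣ B t ∣)
    ≡⟨ sum-cong-≗ last-element ⟨
  ∑[ t < K ] ∑[ x < V ] (𝟙 (x ∈? X) * (𝟙 (S′? x t) * orderings s ∣ A t ∣ ∣ B t - x ∣))
    ≡⟨ ∑-comm (λ t x → 𝟙 (x ∈? X) * (𝟙 (S′? x t) * orderings s ∣ A t ∣ ∣ B t - x ∣)) ⟩
  ∑[ x < V ] ∑[ t < K ] (𝟙 (x ∈? X) * (𝟙 (S′? x t) * orderings s ∣ A t ∣ ∣ B t - x ∣))
    ≡⟨ sum-cong-≗ (λ x → *-distribˡ-sum (𝟙 (x ∈? X)) (λ t → 𝟙 (S′? x t) * orderings s ∣ A t ∣ ∣ B t - x ∣)) ⟨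
  ∑[ x < V ] (𝟙 (x ∈? X) * ∑[ t < K ] (𝟙 (S′? x t) * orderings s ∣ A t ∣ ∣ B t - x ∣))
    ≤⟨ ∑-mono-≤ induction ⟩
  ∑[ x < V ] (𝟙 (x ∈? X) * s !)
    ≡⟨ *-distribʳ-sum (s !) (λ x → 𝟙 (x ∈? X)) ⟨
  (∑[ x < V ] 𝟙 (x ∈? X)) * s !
    ≡⟨ cong (_* s !) (trans (sym (∣p∣≡∑𝟙 X)) ∣X∣≡1+s) ⟩
  suc s * s !
    ∎
  where
  open ≤-Reasoning
  S′? : ∀ x → Decidable (λ t → S t × x ∉ₛ A t)
  S′? x t = S? t ×-dec ¬? (x ∈? A t)
  last-element : ∀ t → ∑[ x < V ] (𝟙 (x ∈? X) * (𝟙 (S′? x t) * orderings s ∣ A t ∣ ∣ B t - x ∣))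
                       ≡ 𝟙 (S? t) * orderings (suc s) ∣ A t ∣ ∣ B t ∣
  last-element t with S? t
  ... | no  _  = ∑-zero (λ x → *-zeroʳ (𝟙 (x ∈? X)))
  ... | yes St = trans (orderings-by-last-element X (A t) (B t) (A⊆X sys St) (B⊆X sys St) (disjoint sys St)
                          ∣X∣≡1+s (sym (suc-pred ∣ B t ∣ {{≢-nonZero (λ ∣Bt∣≡0 → ∄t (t , St , ∣Bt∣≡0))}})))
                       (sym (*-identityˡ _))
  induction : ∀ x → 𝟙 (x ∈? X) * ∑[ t < K ] (𝟙 (S′? x t) * orderings s ∣ A t ∣ ∣ B t - x ∣) ≤ 𝟙 (x ∈? X) * s !
  induction x = 𝟙-*-monoʳ-≤ (x ∈? X) λ x∈X →
    bollobás-weighted s (S′? x) (suc-injective (trans (x∈p⇒suc∣p-x∣≡∣p∣ x∈X) ∣X∣≡1+s)) (delete-point sys x)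

[2r]Cr*[r!*r!]≡[r+r]! : ∀ r → ((2 * r) C r) * (r ! * r !) ≡ (r + r) !
[2r]Cr*[r!*r!]≡[r+r]! r = begin
  ((2 * r) C r) * (r ! * r !)
    ≡⟨ cong (λ k → ((2 * r) C r) * (r ! * k !)) 2r∸r≡r ⟨
  ((2 * r) C r) * (r ! * (2 * r ∸ r) !)
    ≡⟨ cong (_* (r ! * (2 * r ∸ r) !)) (nCk≡n!/k![n-k]! r≤2r) ⟩
  (2 * r) ! / (r ! * (2 * r ∸ r) !) * (r ! * (2 * r ∸ r) !)
    ≡⟨ m/n*n≡m (k![n∸k]!∣n! r≤2r) ⟩
  (2 * r) !
    ≡⟨ cong (λ k → (r + k) !) (+-identityʳ r) ⟩
  (r + r) !
    ∎
  where
  open ≡-Reasoning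
  instance
    r!*[2r∸r]!≢0 : NonZero (r ! * (2 * r ∸ r) !)
    r!*[2r∸r]!≢0 = r !* (2 * r ∸ r) !≢0
  r≤2r : r ≤ 2 * r
  r≤2r = m≤m+n r (r + 0)
  2r∸r≡r : 2 * r ∸ r ≡ r
  2r∸r≡r = trans (m+n∸m≡n r (r + 0)) (+-identityʳ r)

bollobás : ∀ {K V r} {S : Pred (Fin K) 0ℓ} (S? : Decidable S) {A B : Fin K → Subset V} →
  IsBollobásSystem ⊤ S A B → (∀ {t} → S t → ∣ A t ∣ ≡ r × ∣ B t ∣ ≡ r) → ∑[ t < K ] 𝟙 (S? t) ≤ (2 * r) C r
bollobás {K} {V} {r} S? {A} {B} sys uniform with any? S?
... | no  ∄t         = ≤-trans (≤-reflexive (∑-zero (λ t → 𝟙-no (S? t) (λ St → ∄t (t , St))))) z≤n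
... | yes (t₀ , St₀) = *-cancelʳ-≤ count ((2 * r) C r) (V ! * (r ! * r !)) (begin
  count * (V ! * (r ! * r !))               ≡⟨ cong (count *_) (orderings-closed-form V r r 2r≤V) ⟨
  count * (orderings V r r * (r + r) !)     ≡⟨ *-assoc count _ _ ⟨
  count * orderings V r r * (r + r) !       ≤⟨ *-monoˡ-≤ ((r + r) !) weighted ⟩
  V ! * (r + r) !                           ≡⟨ cong (V ! *_) ([2r]Cr*[r!*r!]≡[r+r]! r) ⟨
  V ! * (((2 * r) C r) * (r ! * r !))       ≡⟨ x∙yz≈y∙xz (V !) ((2 * r) C r) (r ! * r !) ⟩
  ((2 * r) C r) * (V ! * (r ! * r !))       ∎)
  where
  open ≤-Reasoning
  open import Algebra.Properties.CommutativeSemigroup *-commutativeSemigroup using (x∙yz≈y∙xz)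
  instance
    V!*[r!*r!]≢0 : NonZero (V ! * (r ! * r !))
    V!*[r!*r!]≢0 = m*n≢0 (V !) (r ! * r !) {{V !≢0}} {{r !* r !≢0}}
  count : ℕ
  count = ∑[ t < K ] 𝟙 (S? t)
  2r≤V : r + r ≤ V
  2r≤V = subst (_≤ V) (cong₂ _+_ (proj₁ (uniform St₀)) (proj₂ (uniform St₀))) (∣p∣+∣q∣≤n (disjoint sys St₀))
  uniformly : ∀ t → 𝟙 (S? t) * orderings V ∣ A t ∣ ∣ B t ∣ ≡ 𝟙 (S? t) * orderings V r r
  uniformly t with S? t
  ... | no  _  = refl
  ... | yes St = cong₂ (λ a b → 1 * orderings V a b) (proj₁ (uniform St)) (proj₂ (uniform St))
  weighted : count * orderings V r r ≤ V !
  weighted = begin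
    count * orderings V r r                              ≡⟨ *-distribʳ-sum (orderings V r r) (λ t → 𝟙 (S? t)) ⟩
    ∑[ t < K ] (𝟙 (S? t) * orderings V r r)              ≡⟨ sum-cong-≗ uniformly ⟨
    ∑[ t < K ] (𝟙 (S? t) * orderings V ∣ A t ∣ ∣ B t ∣)  ≤⟨ bollobás-weighted V S? (∣⊤∣≡n V) sys ⟩
    V !                                                  ∎

module _ (K : ℕ) where

  tag : Fin (K + K) → Fin K × Bool
  tag t = [ (_, true) , (_, false) ]′ (splitAt K t)

  tag-injective : ∀ {t u} → tag t ≡ tag u → t ≡ u
  tag-injective {t} {u} eq = begin
    t                        ≡⟨ join-splitAt K K t ⟨
    join K K (splitAt K t)   ≡⟨ cong (join K K) (splitAt-injective (splitAt K t) (splitAt K u) eq) ⟩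
    join K K (splitAt K u)   ≡⟨ join-splitAt K K u ⟩
    u                        ∎
    where
    open ≡-Reasoning
    splitAt-injective : ∀ x y → [ (_, true) , (_, false) ]′ x ≡ [ (_, true) , (_, false) ]′ y → x ≡ y
    splitAt-injective (inj₁ i) (inj₁ j) refl = refl
    splitAt-injective (inj₂ i) (inj₂ j) refl = refl

  ∑-tag : ∀ (f : Fin K × Bool → ℕ) →
    ∑[ t < K + K ] f (tag t) ≡ ∑[ i < K ] f (i , true) + ∑[ i < K ] f (i , false)
  ∑-tag f = trans (∑-split K (f ∘′ tag)) (cong₂ _+_
    (sum-cong-≗ (λ i → cong (f ∘′ [ (_, true) , (_, false) ]′) (splitAt-↑ˡ K i K)))
    (sum-cong-≗ (λ i → cong (f ∘′ [ (_, true) , (_, false) ]′) (splitAt-↑ʳ K K i))))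

bollobás-symmetric : ∀ {K V r} {S : Pred (Fin K) 0ℓ} (S? : Decidable S) (E : Fin K → Bool → Subset V) → 0 < r →
  (∀ {i} → S i → ∀ b → ∣ E i b ∣ ≡ r) →
  (∀ {i} → S i → Disjoint (E i true) (E i false)) →
  (∀ {i j} → S i → S j → i ≢ j → ∀ b c → Meets (E i b) (E j c)) →
  2 * ∑[ i < K ] 𝟙 (S? i) ≤ (2 * r) C r
bollobás-symmetric {K} {V} {r} {S} S? E 0<r uniform disjoint-pair meet = begin
  2 * count                                    ≡⟨ cong (_+_ count) (+-identityʳ count) ⟩
  count + count                                ≡⟨ ∑-tag K (λ (i , _) → 𝟙 (S? i)) ⟨
  ∑[ t < K + K ] 𝟙 (S? (proj₁ (tag K t)))      ≤⟨ bollobás (λ t → S? (proj₁ (tag K t))) system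
                                                           (λ St → uniform St _ , uniform St _) ⟩
  (2 * r) C r                                  ∎
  where
  open ≤-Reasoning
  count : ℕ
  count = ∑[ i < K ] 𝟙 (S? i)
  A B : Fin (K + K) → Subset V
  A t = E (proj₁ (tag K t)) (proj₂ (tag K t))
  B t = E (proj₁ (tag K t)) (not (proj₂ (tag K t)))
  complementary : ∀ {i} → S i → ∀ b → Disjoint (E i b) (E i (not b))
  complementary Si true  = disjoint-pair Si
  complementary Si false = Disjoint-sym (disjoint-pair Si)
  crossing : ∀ {i j} → S i → S j → ∀ b c → (i , b) ≢ (j , c) → Meets (E i b) (E j (not c))
  crossing {i} {j} Si Sj b c ib≢jc with i Fin.≟ j
  ... | no  i≢j  = meet Si Sj i≢j b (not c)
  ... | yes refl rewrite sym (¬-not (ib≢jc ∘′ cong (i ,_))) =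
    let (x , x∈E) = ∣p∣≢0⇒nonempty (subst (_≢ 0) (sym (uniform Si b)) (>⇒≢ 0<r)) in x , x∈E , x∈E
  system : IsBollobásSystem ⊤ (S ∘′ proj₁ ∘′ tag K) A B
  system = record
    { A⊆X      = λ _ _ → ∈⊤
    ; B⊆X      = λ _ _ → ∈⊤
    ; disjoint = λ {t} St → complementary St (proj₂ (tag K t))
    ; cross    = λ St Su t≢u → crossing St Su _ _ (t≢u ∘′ tag-injective K)
    }

-- Rainbow matchings

AllPairs-lookup : ∀ {a r} {A : Set a} {R : A → A → Set r} → Symmetric R →
  ∀ {xs} → AllPairs R xs → ∀ {i j} → i ≢ j → R (lookup xs i) (lookup xs j)
AllPairs-lookup R-sym (Rx ∷ _)   {zero}  {zero}  i≢j = contradiction refl i≢j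
AllPairs-lookup R-sym (Rx ∷ _)   {zero}  {suc j} _   = All.lookup Rx (∈-lookup j)
AllPairs-lookup R-sym (Rx ∷ _)   {suc i} {zero}  _   = R-sym (All.lookup Rx (∈-lookup i))
AllPairs-lookup R-sym (_  ∷ Rxs) {suc i} {suc j} i≢j = AllPairs-lookup R-sym Rxs (i≢j ∘′ cong suc)

module _ {V n : ℕ} (H : Fin n → List (Edge V)) where

  record Rainbow (L : ℕ) : Set where
    field
      edge             : Fin L → Edge V
      colour           : Fin L → Fin n
      disjoint         : ∀ {a b} → a ≢ b → Disjoint (edge a) (edge b)
      colour-injective : Injective _≡_ _≡_ colour
      edge∈H           : ∀ a → edge a ∈ H (colour a)

    Unused : Fin n → Set
    Unused i = ∀ a → colour a ≢ i

  open Rainbow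

  isRainbow⇒rainbow : ∀ {M} → IsRainbow H M → Rainbow (length M)
  isRainbow⇒rainbow {M} (M-disjoint , φ , φ-injective , M∈H) = record
    { edge             = lookup M
    ; colour           = φ
    ; disjoint         = AllPairs-lookup Disjoint-sym M-disjoint
    ; colour-injective = φ-injective
    ; edge∈H           = M∈H
    }

  rainbow⇒isRainbow : ∀ {L} (R : Rainbow L) → IsRainbow H (tabulate (edge R))
  rainbow⇒isRainbow {L} R =
    AllPairs.tabulate⁺ (disjoint R) ,
    colour R ∘′ cast len≡ ,
    cast-injective ∘′ colour-injective R ,
    λ k → subst (_∈ H (colour R (cast len≡ k))) (sym (lookup-tabulate′ k)) (edge∈H R (cast len≡ k))
    where
    len≡ : length (tabulate (edge R)) ≡ L
    len≡ = length-tabulate (edge R)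
    cast-injective : ∀ {k k′} → cast len≡ k ≡ cast len≡ k′ → k ≡ k′
    cast-injective {k} {k′} eq = begin
      k                               ≡⟨ Finₚ.cast-involutive (sym len≡) len≡ k ⟨
      cast (sym len≡) (cast len≡ k)   ≡⟨ cong (cast (sym len≡)) eq ⟩
      cast (sym len≡) (cast len≡ k′)  ≡⟨ Finₚ.cast-involutive (sym len≡) len≡ k′ ⟩
      k′                              ∎
      where open ≡-Reasoning
    lookup-tabulate′ : ∀ k → lookup (tabulate (edge R)) k ≡ edge R (cast len≡ k)
    lookup-tabulate′ k =
      trans (cong (lookup (tabulate (edge R))) (sym (Finₚ.cast-involutive (sym len≡) len≡ k)))
            (lookup-tabulate (edge R) (cast len≡ k))

  rainbow-size≤ : ∀ {m L} → (∀ M → IsRainbow H M → length M ≤ m) → Rainbow L → L ≤ m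
  rainbow-size≤ M≤m R = subst (_≤ _) (length-tabulate (edge R)) (M≤m _ (rainbow⇒isRainbow R))

  extend : ∀ {L i f} (R : Rainbow L) → f ∈ H i → Unused R i → (∀ a → Disjoint f (edge R a)) → Rainbow (suc L)
  extend {L} {i} {f} R f∈Hi i-unused f-disjoint = record
    { edge             = edge′
    ; colour           = colour′
    ; disjoint         = disjoint′
    ; colour-injective = colour′-injective
    ; edge∈H           = edge′∈H
    }
    where
    edge′ : Fin (suc L) → Edge V
    edge′ = f Vector.∷ edge R
    colour′ : Fin (suc L) → Fin n
    colour′ = i Vector.∷ colour R
    disjoint′ : ∀ {a b} → a ≢ b → Disjoint (edge′ a) (edge′ b)
    disjoint′ {zero}  {zero}  0≢0 = contradiction refl 0≢0
    disjoint′ {zero}  {suc b} _   = f-disjoint b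
    disjoint′ {suc a} {zero}  _   = Disjoint-sym (f-disjoint a)
    disjoint′ {suc a} {suc b} a≢b = disjoint R (a≢b ∘′ cong suc)
    colour′-injective : Injective _≡_ _≡_ colour′
    colour′-injective {zero}  {zero}  _  = refl
    colour′-injective {zero}  {suc b} eq = contradiction (sym eq) (i-unused b)
    colour′-injective {suc a} {zero}  eq = contradiction eq (i-unused a)
    colour′-injective {suc a} {suc b} eq = cong suc (colour-injective R eq)
    edge′∈H : ∀ a → edge′ a ∈ H (colour′ a)
    edge′∈H zero    = f∈Hi
    edge′∈H (suc a) = edge∈H R a

  remove : ∀ {L} (R : Rainbow (suc L)) → Fin (suc L) → Rainbow L
  remove R a = record
    { edge             = edge R ∘′ punchIn a
    ; colour           = colour R ∘′ punchIn a
    ; disjoint         = λ b≢c → disjoint R (b≢c ∘′ Finₚ.punchIn-injective a _ _)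
    ; colour-injective = Finₚ.punchIn-injective a _ _ ∘′ colour-injective R
    ; edge∈H           = λ b → edge∈H R (punchIn a b)
    }

  exchange : ∀ {L i j f g} (R : Rainbow L) (a : Fin L) → f ∈ H i → g ∈ H j → i ≢ j →
    Unused R i → Unused R j → Disjoint f g →
    (∀ b → b ≢ a → Disjoint f (edge R b)) → (∀ b → b ≢ a → Disjoint g (edge R b)) → Rainbow (suc L)
  exchange {suc L} R a f∈Hi g∈Hj i≢j i-unused j-unused f∩g≡∅ f-disjoint g-disjoint =
    extend (extend (remove R a) g∈Hj
                   (λ b → j-unused (punchIn a b))
                   (λ b → g-disjoint (punchIn a b) (Finₚ.punchInᵢ≢i a b)))
           f∈Hi
           (λ where zero    → i≢j ∘′ sym
                    (suc b) → i-unused (punchIn a b))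
           (λ where zero    → f∩g≡∅
                    (suc b) → f-disjoint (punchIn a b) (Finₚ.punchInᵢ≢i a b))

module MaximumRainbow {r N V n m : ℕ} (2≤r : 2 ≤ r) (H : Fin n → List (Edge V))
  (matching : ∀ i → IsMatching r (H i)) (size : ∀ i → length (H i) ≡ N)
  (M : Rainbow H m) (maximality : ∀ {L} → Rainbow H L → L ≤ m) where

  open Rainbow M renaming (edge to e; colour to φ)

  ∣f∣≡r : ∀ {i f} → f ∈ H i → ∣ f ∣ ≡ r
  ∣f∣≡r {i} = All.lookup (proj₁ (matching i))

  ∣e∣≡r : ∀ a → ∣ e a ∣ ≡ r
  ∣e∣≡r a = ∣f∣≡r (edge∈H a)

  H-disjoint : ∀ i → AllPairs Disjoint (H i)
  H-disjoint i = proj₂ (matching i)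

  unused? : Decidable Unused
  unused? i = all? (λ a → ¬? (φ a Fin.≟ i))

  degree : Edge V → ℕ
  degree f = ∑[ a < m ] 𝟙 (meets? f (e a))

  Pure : Fin m → Edge V → Set
  Pure a f = Meets f (e a) × degree f ≡ 1

  pure? : ∀ a → Decidable (Pure a)
  pure? a f = meets? f (e a) ×-dec (degree f ≟ 1)

  pure-disjoint : ∀ {a b f} → Pure a f → b ≢ a → Disjoint f (e b)
  pure-disjoint {a} {b} {f} (f∩ea , degree≡1) b≢a = ¬meets⇒disjoint λ f∩eb → 1+n≰n (begin
    2                                        ≡⟨ cong₂ _+_ (𝟙-yes (meets? f (e b)) f∩eb) (𝟙-yes (meets? f (e a)) f∩ea) ⟨
    𝟙 (meets? f (e b)) + 𝟙 (meets? f (e a))  ≤⟨ f[i]+f[j]≤∑f (λ c → 𝟙 (meets? f (e c))) b≢a ⟩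
    degree f                                 ≡⟨ degree≡1 ⟩
    1                                        ∎)
    where open ≤-Reasoning

  degree-positive : ∀ {i f} → Unused i → f ∈ H i → 1 ≤ degree f
  degree-positive {f = f} i-unused f∈Hi with degree f in degree≡
  ... | suc _ = s≤s z≤n
  ... | zero  = contradiction (maximality (extend H M f∈Hi i-unused f-disjoint)) 1+n≰n
    where
    f-disjoint : ∀ a → Disjoint f (e a)
    f-disjoint a = ¬meets⇒disjoint λ f∩ea → 1+n≰n (begin
      1                      ≡⟨ 𝟙-yes (meets? f (e a)) f∩ea ⟨
      𝟙 (meets? f (e a))     ≤⟨ f[i]≤∑f (λ c → 𝟙 (meets? f (e c))) a ⟩
      degree f               ≡⟨ degree≡ ⟩
      0                      ∎)
      where open ≤-Reasoning

  pure-meet : ∀ {a i j f g} → Unused i → Unused j → i ≢ j → f ∈ H i → g ∈ H j → Pure a f → Pure a g → Meets f g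
  pure-meet {a} {f = f} {g} i-unused j-unused i≢j f∈Hi g∈Hj f-pure g-pure with meets? f g
  ... | yes f∩g = f∩g
  ... | no ¬f∩g = contradiction (maximality larger) 1+n≰n
    where
    larger : Rainbow H (suc m)
    larger = exchange H M a f∈Hi g∈Hj i≢j i-unused j-unused (¬meets⇒disjoint ¬f∩g)
                      (λ _ → pure-disjoint f-pure) (λ _ → pure-disjoint g-pure)

  pureEdges : Fin n → Fin m → List (Edge V)
  pureEdges i a = filter (pure? a) (H i)

  2≤degree+purity : ∀ {f} → 1 ≤ degree f → 2 ≤ degree f + ∑[ a < m ] 𝟙 (pure? a f)
  2≤degree+purity {f} 1≤degree with m≤n⇒m<n∨m≡n 1≤degree
  ... | inj₁ 2≤degree = ≤-trans 2≤degree (m≤m+n (degree f) _)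
  ... | inj₂ 1≡degree = ≤-reflexive (cong₂ _+_ 1≡degree (trans 1≡degree (sum-cong-≗ λ a →
          ≤-antisym (𝟙-mono (_, sym 1≡degree) (meets? f (e a)) (pure? a f))
                    (𝟙-mono proj₁ (pure? a f) (meets? f (e a))))))

  edge-count : ∀ {i} → Unused i → 2 * N ≤ r * m + ∑[ a < m ] length (pureEdges i a)
  edge-count {i} i-unused = begin
    2 * N
      ≡⟨ cong (2 *_) (size i) ⟨
    2 * length (H i)
      ≡⟨ trans (∑ˡ-const (H i) 2) (*-comm (length (H i)) 2) ⟨
    ∑[ f ∈ H i ] 2
      ≤⟨ ∑ˡ-mono-≤ (H i) (2≤degree+purity ∘′ degree-positive i-unused) ⟩
    ∑[ f ∈ H i ] (degree f + ∑[ a < m ] 𝟙 (pure? a f))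
      ≡⟨ ∑ˡ-distrib-+ (H i) degree (λ f → ∑[ a < m ] 𝟙 (pure? a f)) ⟩
    ∑ˡ (H i) degree + ∑[ f ∈ H i ] ∑[ a < m ] 𝟙 (pure? a f)
      ≡⟨ cong₂ _+_ (∑-∑ˡ-comm (H i) λ a f → 𝟙 (meets? f (e a))) (∑-∑ˡ-comm (H i) λ a f → 𝟙 (pure? a f)) ⟨
    ∑[ a < m ] ∑[ f ∈ H i ] 𝟙 (meets? f (e a)) + ∑[ a < m ] ∑[ f ∈ H i ] 𝟙 (pure? a f)
      ≤⟨ +-mono-≤ (∑-mono-≤ λ a → ∑-meets≤∣e∣ (H i) (e a) (H-disjoint i))
                  (≤-reflexive (sum-cong-≗ λ a → ∑ˡ-𝟙≡length-filter (pure? a) (H i))) ⟩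
    ∑[ a < m ] ∣ e a ∣ + ∑[ a < m ] length (pureEdges i a)
      ≡⟨ cong (_+ ∑[ a < m ] length (pureEdges i a))
              (trans (sum-cong-≗ ∣e∣≡r) (trans (∑-const m r) (*-comm m r))) ⟩
    r * m + ∑[ a < m ] length (pureEdges i a)
      ∎
    where open ≤-Reasoning

  pure-count≤r : ∀ i a → length (pureEdges i a) ≤ r
  pure-count≤r i a = begin
    length (pureEdges i a)            ≡⟨ ∑ˡ-𝟙≡length-filter (pure? a) (H i) ⟨
    ∑[ f ∈ H i ] 𝟙 (pure? a f)        ≤⟨ ∑ˡ-mono-≤ (H i) (λ {f} _ → 𝟙-mono proj₁ (pure? a f) (meets? f (e a))) ⟩
    ∑[ f ∈ H i ] 𝟙 (meets? f (e a))   ≤⟨ ∑-meets≤∣e∣ (H i) (e a) (H-disjoint i) ⟩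
    ∣ e a ∣                           ≡⟨ ∣e∣≡r a ⟩
    r                                 ∎
    where open ≤-Reasoning

  Rich : Fin m → Fin n → Set
  Rich a i = 2 ≤ length (pureEdges i a) × Unused i

  rich? : ∀ a → Decidable (Rich a)
  rich? a i = (2 ≤? length (pureEdges i a)) ×-dec unused? i

  rich-count : ∀ a → 2 * ∑[ i < n ] 𝟙 (rich? a i) ≤ (2 * r) C r
  rich-count a = bollobás-symmetric (rich? a) E (≤-trans (s≤s z≤n) 2≤r)
    (λ (2≤p , _) b → ∣f∣≡r (E∈H 2≤p b))
    (λ (2≤p , _) → pickTwo-related 2≤p (AllPairs.filter⁺ (pure? a) (H-disjoint _)))
    (λ (2≤p , i-unused) (2≤q , j-unused) i≢j b c →
       pure-meet i-unused j-unused i≢j (E∈H 2≤p b) (E∈H 2≤q c) (E-pure 2≤p b) (E-pure 2≤q c))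
    where
    E : Fin n → Bool → Edge V
    E i = pickTwo (pureEdges i a)
    E∈H : ∀ {i} → 2 ≤ length (pureEdges i a) → ∀ b → E i b ∈ H i
    E∈H {i} 2≤p b = proj₁ (∈-filter⁻ (pure? a) {xs = H i} (pickTwo-∈ 2≤p b))
    E-pure : ∀ {i} → 2 ≤ length (pureEdges i a) → ∀ b → Pure a (E i b)
    E-pure {i} 2≤p b = proj₂ (∈-filter⁻ (pure? a) {xs = H i} (pickTwo-∈ 2≤p b))

  excess : Fin n → ℕ
  excess i = ∑[ a < m ] (length (pureEdges i a) ∸ 1)

  excess-bound : ∀ a →
    ∑[ i < n ] (𝟙 (unused? i) * (length (pureEdges i a) ∸ 1)) ≤ (r ∸ 1) * ∑[ i < n ] 𝟙 (rich? a i)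
  excess-bound a = begin
    ∑[ i < n ] (𝟙 (unused? i) * (length (pureEdges i a) ∸ 1)) ≤⟨ ∑-mono-≤ pointwise ⟩
    ∑[ i < n ] ((r ∸ 1) * 𝟙 (rich? a i))                        ≡⟨ *-distribˡ-sum (r ∸ 1) (λ i → 𝟙 (rich? a i)) ⟨
    (r ∸ 1) * ∑[ i < n ] 𝟙 (rich? a i)                          ∎
    where
    open ≤-Reasoning
    excess≤ : ∀ x {p} → p ≤ r → x * (p ∸ 1) ≤ (r ∸ 1) * (𝟙 (2 ≤? p) * x)
    excess≤ x {p} p≤r with 2 ≤? p
    ... | yes 2≤p = begin
      x * (p ∸ 1)                  ≤⟨ *-monoʳ-≤ x (∸-monoˡ-≤ 1 p≤r) ⟩
      x * (r ∸ 1)                  ≡⟨ *-comm x (r ∸ 1) ⟩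
      (r ∸ 1) * x                  ≡⟨ cong ((r ∸ 1) *_) (*-identityˡ x) ⟨
      (r ∸ 1) * (1 * x)            ≡⟨ cong (λ y → (r ∸ 1) * (y * x)) (𝟙-yes (2 ≤? p) 2≤p) ⟨
      (r ∸ 1) * (𝟙 (2 ≤? p) * x)   ∎
    ... | no p≱2 = begin
      x * (p ∸ 1)                  ≡⟨ cong (x *_) (m≤n⇒m∸n≡0 (≤-pred (≰⇒> p≱2))) ⟩
      x * 0                        ≡⟨ *-zeroʳ x ⟩
      0                            ≤⟨ z≤n ⟩
      (r ∸ 1) * (𝟙 (2 ≤? p) * x)   ∎
    pointwise : ∀ i → 𝟙 (unused? i) * (length (pureEdges i a) ∸ 1) ≤ (r ∸ 1) * 𝟙 (rich? a i)
    pointwise i = subst (𝟙 (unused? i) * (length (pureEdges i a) ∸ 1) ≤_)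
                        (cong ((r ∸ 1) *_) (sym (𝟙-×-dec (2 ≤? length (pureEdges i a)) (unused? i))))
                        (excess≤ (𝟙 (unused? i)) (pure-count≤r i a))

  excess-of-unused : ∀ {i} → Unused i → 2 * N ∸ suc r * m ≤ excess i
  excess-of-unused {i} i-unused = m≤n+o⇒m∸n≤o (2 * N) (suc r * m) (begin
    2 * N
      ≤⟨ edge-count i-unused ⟩
    r * m + ∑[ a < m ] length (pureEdges i a)
      ≤⟨ +-monoʳ-≤ (r * m) (∑-mono-≤ λ a → m≤n+m∸n (length (pureEdges i a)) 1) ⟩
    r * m + ∑[ a < m ] (1 + (length (pureEdges i a) ∸ 1))
      ≡⟨ cong (_+_ (r * m)) (∑-distrib-+ (λ _ → 1) (λ a → length (pureEdges i a) ∸ 1)) ⟩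
    r * m + (∑[ a < m ] 1 + excess i)
      ≡⟨ cong (λ k → r * m + (k + excess i)) (trans (∑-const m 1) (*-identityʳ m)) ⟩
    r * m + (m + excess i)
      ≡⟨ +-assoc (r * m) m (excess i) ⟨
    r * m + m + excess i
      ≡⟨ cong (_+ excess i) (+-comm (r * m) m) ⟩
    suc r * m + excess i
      ∎)
    where open ≤-Reasoning

  unused-count : ℕ
  unused-count = ∑[ i < n ] 𝟙 (unused? i)

  n≤m+unused-count : n ≤ m + unused-count
  n≤m+unused-count = begin
    n
      ≡⟨ trans (∑-const n 1) (*-identityʳ n) ⟨
    ∑[ i < n ] 1
      ≤⟨ ∑-mono-≤ used-or-unused ⟩
    ∑[ i < n ] (∑[ a < m ] 𝟙 (φ a Fin.≟ i) + 𝟙 (unused? i))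
      ≡⟨ ∑-distrib-+ (λ i → ∑[ a < m ] 𝟙 (φ a Fin.≟ i)) (λ i → 𝟙 (unused? i)) ⟩
    ∑[ i < n ] ∑[ a < m ] 𝟙 (φ a Fin.≟ i) + unused-count
      ≡⟨ cong (_+ unused-count) (∑-comm (λ i a → 𝟙 (φ a Fin.≟ i))) ⟩
    ∑[ a < m ] ∑[ i < n ] 𝟙 (φ a Fin.≟ i) + unused-count
      ≡⟨ cong (_+ unused-count) (trans (sum-cong-≗ one-colour) (trans (∑-const m 1) (*-identityʳ m))) ⟩
    m + unused-count
      ∎
    where
    open ≤-Reasoning
    used-or-unused : ∀ i → 1 ≤ ∑[ a < m ] 𝟙 (φ a Fin.≟ i) + 𝟙 (unused? i)
    used-or-unused i with any? (λ a → φ a Fin.≟ i)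
    ... | yes (a , φa≡i) = ≤-trans (≤-trans (≤-reflexive (sym (𝟙-yes (φ a Fin.≟ i) φa≡i)))
                                            (f[i]≤∑f (λ b → 𝟙 (φ b Fin.≟ i)) a))
                                   (m≤m+n _ _)
    ... | no  ∄a         = ≤-trans (≤-reflexive (sym (𝟙-yes (unused? i) (λ a φa≡i → ∄a (a , φa≡i)))))
                                   (m≤n+m _ _)
    one-colour : ∀ a → ∑[ i < n ] 𝟙 (φ a Fin.≟ i) ≡ 1
    one-colour a = trans (∑-single (λ i → 𝟙 (φ a Fin.≟ i)) (φ a) (λ i i≢φa → 𝟙-no (φ a Fin.≟ i) (i≢φa ∘′ sym)))
                         (𝟙-yes (φ a Fin.≟ φ a) refl)

  total-excess : ℕ
  total-excess = ∑[ i < n ] (𝟙 (unused? i) * excess i)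

  unused-count*[2N∸[r+1]m]≤total-excess : unused-count * (2 * N ∸ suc r * m) ≤ total-excess
  unused-count*[2N∸[r+1]m]≤total-excess = begin
    unused-count * (2 * N ∸ suc r * m)
      ≡⟨ *-distribʳ-sum (2 * N ∸ suc r * m) (λ i → 𝟙 (unused? i)) ⟩
    ∑[ i < n ] (𝟙 (unused? i) * (2 * N ∸ suc r * m))
      ≤⟨ ∑-mono-≤ (λ i → 𝟙-*-monoʳ-≤ (unused? i) excess-of-unused) ⟩
    total-excess
      ∎
    where open ≤-Reasoning

  2*total-excess≤ : 2 * total-excess ≤ m * ((r ∸ 1) * ((2 * r) C r))
  2*total-excess≤ = begin
    2 * total-excess
      ≡⟨ cong (2 *_) (trans (sum-cong-≗ λ i → *-distribˡ-sum (𝟙 (unused? i)) (λ a → length (pureEdges i a) ∸ 1))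
                            (∑-comm λ i a → 𝟙 (unused? i) * (length (pureEdges i a) ∸ 1))) ⟩
    2 * ∑[ a < m ] ∑[ i < n ] (𝟙 (unused? i) * (length (pureEdges i a) ∸ 1))
      ≤⟨ *-monoʳ-≤ 2 (∑-mono-≤ excess-bound) ⟩
    2 * ∑[ a < m ] ((r ∸ 1) * ∑[ i < n ] 𝟙 (rich? a i))
      ≡⟨ *-distribˡ-sum 2 (λ a → (r ∸ 1) * ∑[ i < n ] 𝟙 (rich? a i)) ⟩
    ∑[ a < m ] (2 * ((r ∸ 1) * ∑[ i < n ] 𝟙 (rich? a i)))
      ≡⟨ sum-cong-≗ (λ a → x∙yz≈y∙xz 2 (r ∸ 1) (∑[ i < n ] 𝟙 (rich? a i))) ⟩
    ∑[ a < m ] ((r ∸ 1) * (2 * ∑[ i < n ] 𝟙 (rich? a i)))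
      ≤⟨ ∑-mono-≤ (λ a → *-monoʳ-≤ (r ∸ 1) (rich-count a)) ⟩
    ∑[ a < m ] ((r ∸ 1) * ((2 * r) C r))
      ≡⟨ ∑-const m _ ⟩
    m * ((r ∸ 1) * ((2 * r) C r))
      ∎
    where
    open ≤-Reasoning
    open import Algebra.Properties.CommutativeSemigroup *-commutativeSemigroup using (x∙yz≈y∙xz)

  lemma2p1-ℕ : 2 * (n ∸ m) * (2 * N ∸ suc r * m) ≤ (r ∸ 1) * ((2 * r) C r) * m
  lemma2p1-ℕ = begin
    2 * (n ∸ m) * (2 * N ∸ suc r * m)         ≤⟨ *-monoˡ-≤ _ (*-monoʳ-≤ 2 (m≤n+o⇒m∸n≤o n m n≤m+unused-count)) ⟩
    2 * unused-count * (2 * N ∸ suc r * m)    ≡⟨ *-assoc 2 unused-count _ ⟩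
    2 * (unused-count * (2 * N ∸ suc r * m))  ≤⟨ *-monoʳ-≤ 2 unused-count*[2N∸[r+1]m]≤total-excess ⟩
    2 * total-excess                          ≤⟨ 2*total-excess≤ ⟩
    m * ((r ∸ 1) * ((2 * r) C r))             ≡⟨ *-comm m _ ⟩
    (r ∸ 1) * ((2 * r) C r) * m               ∎
    where open ≤-Reasoning

+m-+n≡+[m∸n] : ∀ {m n} → n ≤ m → + m -ℤ + n ≡ + (m ∸ n)
+m-+n≡+[m∸n] {m} {n} n≤m = trans (ℤ.m-n≡m⊖n m n) (ℤ.⊖-≥ n≤m)

+x*+y*+z≡+[x*y*z] : ∀ x y z → (+ x *ℤ + y) *ℤ + z ≡ + (x * y * z)
+x*+y*+z≡+[x*y*z] x y z = sym (trans (ℤ.pos-* (x * y) z) (cong (_*ℤ + z) (ℤ.pos-* x y)))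

ℕ-bound⇒ℤ-bound : ∀ {k a b c d e f} → b ≤ a → (d ≤ c → k * (a ∸ b) * (c ∸ d) ≤ e * f) →
  (+ k *ℤ (+ a -ℤ + b)) *ℤ (+ c -ℤ + d) ≤ℤ + e *ℤ + f
ℕ-bound⇒ℤ-bound {k} {a} {b} {c} {d} {e} {f} b≤a bound with d ≤? c
... | yes d≤c = begin
  (+ k *ℤ (+ a -ℤ + b)) *ℤ (+ c -ℤ + d)
    ≡⟨ cong₂ (λ x y → (+ k *ℤ x) *ℤ y) (+m-+n≡+[m∸n] b≤a) (+m-+n≡+[m∸n] d≤c) ⟩
  (+ k *ℤ + (a ∸ b)) *ℤ + (c ∸ d)
    ≡⟨ +x*+y*+z≡+[x*y*z] k (a ∸ b) (c ∸ d) ⟩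
  + (k * (a ∸ b) * (c ∸ d))
    ≤⟨ +≤+ (bound d≤c) ⟩
  + (e * f)
    ≡⟨ ℤ.pos-* e f ⟩
  + e *ℤ + f
    ∎
  where open ℤ.≤-Reasoning
... | no d≰c = begin
  (+ k *ℤ (+ a -ℤ + b)) *ℤ (+ c -ℤ + d)
    ≡⟨ cong₂ (λ x y → (+ k *ℤ x) *ℤ y) (+m-+n≡+[m∸n] b≤a) (trans (ℤ.m-n≡m⊖n c d) (ℤ.⊖-≰ d≰c)) ⟩
  (+ k *ℤ + (a ∸ b)) *ℤ - + (d ∸ c)
    ≡⟨ ℤ.neg-distribʳ-* (+ k *ℤ + (a ∸ b)) (+ (d ∸ c)) ⟨
  - ((+ k *ℤ + (a ∸ b)) *ℤ + (d ∸ c))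
    ≡⟨ cong -_ (+x*+y*+z≡+[x*y*z] k (a ∸ b) (d ∸ c)) ⟩
  - + (k * (a ∸ b) * (d ∸ c))
    ≤⟨ ℤ.neg-≤-pos ⟩
  + (e * f)
    ≡⟨ ℤ.pos-* e f ⟩
  + e *ℤ + f
    ∎
  where open ℤ.≤-Reasoning

lemma2p1 : (r n N V m : ℕ) → 2 ≤ r →
    (H : Fin n → List (Edge V)) →
    (∀ i → IsMatching r (H i)) →
    (∀ i → length (H i) ≡ N) →
    IsMaxRainbowSize H m →
    ((+ 2) *ℤ ((+ n) -ℤ (+ m))) *ℤ ((+ (2 * N)) -ℤ (+ (suc r * m)))
      ≤ℤ (+ ((r ∸ 1) * ((2 * r) C r))) *ℤ (+ m)
lemma2p1 r n N V m 2≤r H matching size ((M , M-rainbow , refl) , maximum) =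
  ℕ-bound⇒ℤ-bound {k = 2} {c = 2 * N} {d = suc r * m} {e = (r ∸ 1) * ((2 * r) C r)}
    (Finₚ.injective⇒≤ (Rainbow.colour-injective R))
    (λ _ → MaximumRainbow.lemma2p1-ℕ 2≤r H matching size R (rainbow-size≤ H maximum))
  where R = isRainbow⇒rainbow H M-rainbow
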